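{- Let $T$ be a tree with diameter three. Then $\chi'_s(T)=n_1(T)+1$ and $\chi'_{es}(T)=\chi'_s(T)$.
   Context: A proper edge $k$-coloring of a graph $G$ is a vertex distinguishing edge $k$-coloring (vdec) if for any two distinct vertices $u,v$ the set of colors on edges incident to $u$ differs from that of $v$. $\chi'_s(G)$ is the minimum $k$ such that $G$ has a $k$-vdec. A $k$-vdec is equitable if its color classes pairwise differ in size by at most one; $\chi'_{es}(G)$ is the minimum $k$ admitting an equitable $k$-vdec. $n_1(T)$ is the number of leaves (degree-one vertices) of $T$. -}

module Defs where

open import Data.Nat using (ℕ; zero; suc; _+_; _≤_; _<_; _<ᵇ_)
open import Data.Bool using (Bool; true; false; if_then_else_; _∧_)
open import Data.Fin using (Fin; toℕ)
import Data.Fin as F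
open import Data.List using (List; []; _∷_; _++_; [_]; length)
open import Data.List.Relation.Unary.Unique.Propositional using (Unique)
open import Data.Unit using (⊤)
open import Data.Product using (Σ; ∃; _×_; _,_)
open import Relation.Nullary using (¬_; does)
open import Relation.Binary.PropositionalEquality using (_≡_; _≢_)
open import Function.Bundles using (_⇔_)

record Graph (n : ℕ) : Set where
  field
    adj     : Fin n → Fin n → Bool
    sym     : ∀ u v → adj u v ≡ adj v u
    irrefl  : ∀ u → adj u u ≡ false
open Graph public

ΣFin : (n : ℕ) → (Fin n → ℕ) → ℕ
ΣFin zero    f = 0
ΣFin (suc n) f = f F.zero + ΣFin n (λ i → f (F.suc i))

b2n : Bool → ℕ
b2n true  = 1
b2n false = 0

module _ {n : ℕ} (G : Graph n) where

  degree : Fin n → ℕ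
  degree u = ΣFin n (λ v → b2n (adj G u v))

  n₁ : ℕ
  n₁ = ΣFin n (λ u → b2n (does (Data.Nat._≟_ (degree u) 1)))

  data Walk : Fin n → Fin n → ℕ → Set where
    here : ∀ {u} → Walk u u 0
    step : ∀ {u v w k} → adj G u v ≡ true → Walk v w k → Walk u w (suc k)

  Connected : Set
  Connected = ∀ u v → ∃ λ k → Walk u v k

  Chain : List (Fin n) → Set
  Chain []           = ⊤
  Chain (x ∷ [])     = ⊤
  Chain (x ∷ y ∷ xs) = (adj G x y ≡ true) × Chain (y ∷ xs)

  HasCycle : Set
  HasCycle = Σ (Fin n) λ x → Σ (List (Fin n)) λ ys →
               Unique (x ∷ ys) × (2 ≤ length ys) × Chain (x ∷ ys ++ [ x ])

  IsTree : Set
  IsTree = Connected × ¬ HasCycle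

  DistLE : Fin n → Fin n → ℕ → Set
  DistLE u v k = ∃ λ j → j ≤ k × Walk u v j

  Diameter3 : Set
  Diameter3 = (∀ u v → DistLE u v 3) × (∃ λ u → ∃ λ v → ¬ DistLE u v 2)

  -- Edge colourings with colours Fin k, given as a symmetric function on
  -- vertex pairs (only its values on edges matter).
  module _ {k : ℕ} (c : Fin n → Fin n → Fin k) where

    IsEdgeColouring : Set
    IsEdgeColouring = ∀ u v → adj G u v ≡ true → c u v ≡ c v u

    Proper : Set
    Proper = ∀ u v w → adj G u v ≡ true → adj G u w ≡ true → v ≢ w → c u v ≢ c u w

    _∈Col_ : Fin k → Fin n → Set
    α ∈Col u = ∃ λ v → adj G u v ≡ true × c u v ≡ α

    VertexDistinguishing : Set
    VertexDistinguishing = ∀ u v → u ≢ v → ¬ (∀ α → (α ∈Col u) ⇔ (α ∈Col v))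

    IsVdec : Set
    IsVdec = IsEdgeColouring × Proper × VertexDistinguishing

    classSize : Fin k → ℕ
    classSize α = ΣFin n λ u → ΣFin n λ v →
      b2n ((toℕ u <ᵇ toℕ v) ∧ adj G u v ∧ does (α F.≟ c u v))

    Equitable : Set
    Equitable = ∀ α β → classSize α ≤ suc (classSize β)

  HasVdec : ℕ → Set
  HasVdec k = Σ (Fin n → Fin n → Fin k) IsVdec

  HasEqVdec : ℕ → Set
  HasEqVdec k = Σ (Fin n → Fin n → Fin k) λ c → IsVdec c × Equitable c

  ChiS≡ : ℕ → Set
  ChiS≡ m = HasVdec m × (∀ k → HasVdec k → m ≤ k)

  ChiES≡ : ℕ → Set
  ChiES≡ m = HasEqVdec m × (∀ k → HasEqVdec k → m ≤ k)

-- A tree of diameter three is a double star: two adjacent centres a and b, each with a further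
-- neighbour, and every other vertex a leaf adjacent to exactly one centre (each failure would close
-- a cycle of length at most 7, as all distances are at most 3). Let stem x be the centre x hangs on,
-- with stem a = b and stem b = a. Every edge is {x , stem x}, and x ↦ {x , stem x} is a bijection
-- from the vertices other than b onto the edges, so there are n₁ + 1 edges. Giving every edge its
-- own colour is proper and trivially equitable, and it distinguishes vertices because the colour set
-- of x records the stem edges through x. Conversely, any vertex distinguishing colouring gives the
-- n₁ + 1 edges distinct colours: two leaf edges are told apart by the singleton colour sets of the
-- leaves, and a leaf edge meets the central edge ab.

module Submission where

open import Defs renaming (sym to adj-sym)
import Data.Nat as ℕ
open import Data.Nat using (ℕ; zero; suc; _+_; _*_; _≤_; _<_; z≤n; s≤s; z<s; _<ᵇ_)
open import Data.Nat.Properties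
open import Data.Fin as Fin using (Fin; toℕ; punchIn; punchOut) renaming (zero to fz; suc to fs)
open import Data.Fin.Properties as Finₚ using (punchInᵢ≢i; punchIn-punchOut)
open import Data.Vec.Functional using (removeAt)
open import Data.Product using (_×_; _,_; proj₁; proj₂; ∃)
open import Data.Sum using (_⊎_; inj₁; inj₂; [_,_]′)
open import Data.Bool using (true; false; T; if_then_else_; _∧_)
open import Data.Bool.Properties as Bool using (T-∧; T-≡)
open import Data.Empty using (⊥; ⊥-elim)
open import Data.Unit using (tt)
open import Data.List using ([]; _∷_)
open import Data.List.Relation.Unary.All using ([]; _∷_)
open import Data.List.Relation.Unary.AllPairs using ([]; _∷_)
open import Relation.Nullary using (¬_; Dec; yes; no; does; contradiction; _⊎-dec_)
open import Relation.Nullary.Decidable using (toWitness; isYes≗does; dec-true; dec-false)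
open import Function using (_∘_; _⇔_; mk⇔; Equivalence)
open import Function.Construct.Symmetry using (⇔-sym)
open import Relation.Binary.PropositionalEquality
open import Algebra.Properties.CommutativeMonoid.Sum +-0-commutativeMonoid using (sum; sum-remove; sum-cong-≗)

ΣFin≡sum : ∀ {n} (f : Fin n → ℕ) → ΣFin n f ≡ sum f
ΣFin≡sum {zero}  f = refl
ΣFin≡sum {suc n} f = cong (f fz +_) (ΣFin≡sum (f ∘ fs))

ΣFin-cong : ∀ {n} {f g : Fin n → ℕ} → (∀ i → f i ≡ g i) → ΣFin n f ≡ ΣFin n g
ΣFin-cong {f = f} {g} f≗g = trans (ΣFin≡sum f) (trans (sum-cong-≗ f≗g) (sym (ΣFin≡sum g)))

ΣFin-removeAt : ∀ {n} (f : Fin (suc n) → ℕ) i → ΣFin (suc n) f ≡ f i + ΣFin n (removeAt f i)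
ΣFin-removeAt f i =
  trans (ΣFin≡sum f) (trans (sum-remove f) (cong (f i +_) (sym (ΣFin≡sum (removeAt f i)))))

ΣFin-const : ∀ n c → ΣFin n (λ _ → c) ≡ n * c
ΣFin-const zero    c = refl
ΣFin-const (suc n) c = cong (c +_) (ΣFin-const n c)

ΣFin-≥ : ∀ {n} (f : Fin n → ℕ) i → f i ≤ ΣFin n f
ΣFin-≥ {suc n} f i rewrite ΣFin-removeAt f i = m≤m+n (f i) _

ΣFin-zero : ∀ {n} {f : Fin n → ℕ} → (∀ i → f i ≡ 0) → ΣFin n f ≡ 0
ΣFin-zero {n} f≗0 = trans (ΣFin-cong f≗0) (trans (ΣFin-const n 0) (*-zeroʳ n))

ΣFin-one : ∀ {n} {f : Fin n → ℕ} → (∀ i → f i ≡ 1) → ΣFin n f ≡ n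
ΣFin-one {n} f≗1 = trans (ΣFin-cong f≗1) (trans (ΣFin-const n 1) (*-identityʳ n))

ΣFin-point : ∀ {n} (f : Fin n → ℕ) t → f t ≡ 1 → (∀ i → i ≢ t → f i ≡ 0) → ΣFin n f ≡ 1
ΣFin-point {suc n} f t ft≡1 f≡0 = begin
  ΣFin (suc n) f               ≡⟨ ΣFin-removeAt f t ⟩
  f t + ΣFin n (removeAt f t)  ≡⟨ cong₂ _+_ ft≡1 (ΣFin-zero (λ i → f≡0 _ (punchInᵢ≢i t i))) ⟩
  1                            ∎
  where open ≡-Reasoning

ΣFin-allBut : ∀ {n} (f : Fin n → ℕ) t → f t ≡ 0 → (∀ i → i ≢ t → f i ≡ 1) →
              suc (ΣFin n f) ≡ n
ΣFin-allBut {suc n} f t ft≡0 f≡1 = cong suc (begin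
  ΣFin (suc n) f               ≡⟨ ΣFin-removeAt f t ⟩
  f t + ΣFin n (removeAt f t)  ≡⟨ cong₂ _+_ ft≡0 (ΣFin-one (λ i → f≡1 _ (punchInᵢ≢i t i))) ⟩
  n                            ∎)
  where open ≡-Reasoning

ΣFin-≥2 : ∀ {n} (f : Fin n → ℕ) {i j} → i ≢ j → 1 ≤ f i → 1 ≤ f j → 2 ≤ ΣFin n f
ΣFin-≥2 {suc n} f {i} {j} i≢j 1≤fi 1≤fj = begin
  2                                     ≤⟨ +-mono-≤ 1≤fi 1≤fj ⟩
  f i + f j                             ≡⟨ cong (λ k → f i + f k) (punchIn-punchOut i≢j) ⟨
  f i + removeAt f i (punchOut i≢j)     ≤⟨ +-monoʳ-≤ (f i) (ΣFin-≥ (removeAt f i) (punchOut i≢j)) ⟩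
  f i + ΣFin n (removeAt f i)           ≡⟨ ΣFin-removeAt f i ⟨
  ΣFin (suc n) f                        ∎
  where open ≤-Reasoning

ΣFin-positive : ∀ {n} (f : Fin n → ℕ) → 1 ≤ ΣFin n f → ∃ λ i → 1 ≤ f i
ΣFin-positive {suc n} f 1≤Σ with f fz in e
... | suc _ = fz , subst (1 ≤_) (sym e) (s≤s z≤n)
... | zero with ΣFin-positive (λ i → f (fs i)) 1≤Σ
...   | i , 1≤fi = fs i , 1≤fi

ΣFin-≤1 : ∀ {n} (f : Fin n → ℕ) → (∀ i → f i ≤ 1) →
          (∀ {i j} → 1 ≤ f i → 1 ≤ f j → i ≡ j) → ΣFin n f ≤ 1
ΣFin-≤1 {zero}  f f≤1 unique = z≤n
ΣFin-≤1 {suc n} f f≤1 unique with f fz in e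
... | zero  = ΣFin-≤1 (λ i → f (fs i)) (λ i → f≤1 (fs i)) (λ p q → Finₚ.suc-injective (unique p q))
... | suc k = begin
  suc k + ΣFin n (λ i → f (fs i))  ≡⟨ cong (suc k +_) (ΣFin-zero rest≡0) ⟩
  suc k + 0                        ≡⟨ +-identityʳ (suc k) ⟩
  suc k                            ≡⟨ e ⟨
  f fz                             ≤⟨ f≤1 fz ⟩
  1                                ∎
  where
  open ≤-Reasoning
  rest≡0 : ∀ i → f (fs i) ≡ 0
  rest≡0 i = n<1⇒n≡0 (≰⇒> λ 1≤fi → Finₚ.0≢1+n (unique (subst (1 ≤_) (sym e) (s≤s z≤n)) 1≤fi))

ΣFin²-≤1 : ∀ {m n} (g : Fin m → Fin n → ℕ) → (∀ u v → g u v ≤ 1) →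
           (∀ {u v u′ v′} → 1 ≤ g u v → 1 ≤ g u′ v′ → u ≡ u′ × v ≡ v′) →
           ΣFin m (λ u → ΣFin n (g u)) ≤ 1
ΣFin²-≤1 {n = n} g g≤1 unique =
  ΣFin-≤1 _ (λ u → ΣFin-≤1 (g u) (g≤1 u) (λ p q → proj₂ (unique p q))) row-unique
  where
  row-unique : ∀ {u u′} → 1 ≤ ΣFin n (g u) → 1 ≤ ΣFin n (g u′) → u ≡ u′
  row-unique {u} {u′} p q with ΣFin-positive (g u) p | ΣFin-positive (g u′) q
  ... | _ , 1≤guv | _ , 1≤gu′v′ = proj₁ (unique 1≤guv 1≤gu′v′)

b2n≤1 : ∀ β → b2n β ≤ 1
b2n≤1 true  = s≤s z≤n
b2n≤1 false = z≤n

1≤b2n⇒T : ∀ {β} → 1 ≤ b2n β → T β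
1≤b2n⇒T {true} _ = _

SameEdge : {A : Set} → A × A → A × A → Set
SameEdge (u , v) (u′ , v′) = (u ≡ u′ × v ≡ v′) ⊎ (u ≡ v′ × v ≡ u′)

module _ {A : Set} where

  SameEdge-refl : ∀ {e : A × A} → SameEdge e e
  SameEdge-refl = inj₁ (refl , refl)

  SameEdge-swap : ∀ {u v : A} → SameEdge (u , v) (v , u)
  SameEdge-swap = inj₂ (refl , refl)

  SameEdge-sym : ∀ {e e′ : A × A} → SameEdge e e′ → SameEdge e′ e
  SameEdge-sym (inj₁ (refl , refl)) = SameEdge-refl
  SameEdge-sym (inj₂ (refl , refl)) = SameEdge-swap

  SameEdge-trans : ∀ {e e′ e″ : A × A} → SameEdge e e′ → SameEdge e′ e″ → SameEdge e e″
  SameEdge-trans (inj₁ (refl , refl)) q                    = q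
  SameEdge-trans (inj₂ (refl , refl)) (inj₁ (refl , refl)) = SameEdge-swap
  SameEdge-trans (inj₂ (refl , refl)) (inj₂ (refl , refl)) = SameEdge-refl

SameEdge-ordered : ∀ {n} {u v u′ v′ : Fin n} → toℕ u < toℕ v → toℕ u′ < toℕ v′ →
                   SameEdge (u , v) (u′ , v′) → u ≡ u′ × v ≡ v′
SameEdge-ordered _   _     (inj₁ uv≡u′v′)      = uv≡u′v′
SameEdge-ordered u<v u′<v′ (inj₂ (refl , refl)) = ⊥-elim (<-asym u<v u′<v′)

module Adjacency {n : ℕ} (G : Graph n) where

  infix 4 _~_
  _~_ : Fin n → Fin n → Set
  x ~ y = adj G x y ≡ true

  ~-sym : ∀ {x y} → x ~ y → y ~ x
  ~-sym {x} {y} x~y = trans (adj-sym G y x) x~y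

  ~⇒≢ : ∀ {x y} → x ~ y → x ≢ y
  ~⇒≢ {x} x~x refl with trans (sym x~x) (irrefl G x)
  ... | ()

  _~?_ : ∀ x y → Dec (x ~ y)
  x ~? y = adj G x y Bool.≟ true

  ~⇒1≤b2n : ∀ {x y} → x ~ y → 1 ≤ b2n (adj G x y)
  ~⇒1≤b2n x~y rewrite x~y = s≤s z≤n

module _ {n : ℕ} (G : Graph n) {k : ℕ} (c : Fin n → Fin n → Fin k) where
  open Adjacency G

  ∈Col-unique-nbr : ∀ {x t α} → (∀ {y} → x ~ y → y ≡ t) → _∈Col_ G c α x → α ≡ c x t
  ∈Col-unique-nbr unique (y , x~y , refl) = cong (c _) (unique x~y)

  meeting-edges-colour-≢ : IsEdgeColouring G c → Proper G c →
                           ∀ {p q r} → p ~ q → r ~ q → p ≢ r → c p q ≢ c r q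
  meeting-edges-colour-≢ sym-c proper {p} {q} {r} p~q r~q p≢r cpq≡crq =
    proper q p r (~-sym p~q) (~-sym r~q) p≢r
      (trans (sym (sym-c p q p~q)) (trans cpq≡crq (sym-c r q r~q)))

  counted-pair⇒edge : ∀ {α u v} → 1 ≤ b2n ((toℕ u <ᵇ toℕ v) ∧ adj G u v ∧ does (α Fin.≟ c u v)) →
                      toℕ u < toℕ v × u ~ v × α ≡ c u v
  counted-pair⇒edge {α} {u} {v} counted with Equivalence.to T-∧ (1≤b2n⇒T counted)
  ... | u<ᵇv , rest with Equivalence.to T-∧ rest
  ...   | u~v , α≡cuv =
    <ᵇ⇒< _ _ u<ᵇv , Equivalence.to T-≡ u~v , toWitness (subst T (sym (isYes≗does (α Fin.≟ c u v))) α≡cuv)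

  edge-injective⇒equitable :
    (∀ {u v u′ v′} → u ~ v → u′ ~ v′ → c u v ≡ c u′ v′ → SameEdge (u , v) (u′ , v′)) → Equitable G c
  edge-injective⇒equitable injective α β = ≤-trans classSize≤1 z<s
    where
    classSize≤1 : classSize G c α ≤ 1
    classSize≤1 = ΣFin²-≤1 _ (λ u v → b2n≤1 _) λ p q → unique (counted-pair⇒edge p) (counted-pair⇒edge q)
      where
      unique : ∀ {u v u′ v′} → toℕ u < toℕ v × u ~ v × α ≡ c u v →
               toℕ u′ < toℕ v′ × u′ ~ v′ × α ≡ c u′ v′ → u ≡ u′ × v ≡ v′
      unique (u<v , u~v , α≡cuv) (u′<v′ , u′~v′ , α≡cu′v′) =
        SameEdge-ordered u<v u′<v′ (injective u~v u′~v′ (trans (sym α≡cuv) α≡cu′v′))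

module _ {n : ℕ} (G : Graph n) where
  open Adjacency G

  record IsDoubleStar (a b : Fin n) : Set where
    field
      centres-adj : a ~ b
      pendantᵃ    : ∃ λ u → u ~ a × u ≢ b
      pendantᵇ    : ∃ λ v → v ~ b × v ≢ a
      leaf-hub    : ∀ {x} → x ≢ a → x ≢ b → x ~ a ⊎ x ~ b
      leaf-nbr    : ∀ {x y} → x ≢ a → x ≢ b → x ~ y → y ≡ a ⊎ y ≡ b
      ¬adj-both   : ∀ {x} → x ~ a → x ~ b → ⊥

module Acyclic {n : ℕ} (G : Graph n) (acyclic : ¬ HasCycle G) where
  open Adjacency G

  ¬cycle₃ : ∀ {x₁ x₂ x₃} → x₁ ~ x₂ → x₂ ~ x₃ → x₃ ~ x₁ → ⊥
  ¬cycle₃ {x₁} {x₂} {x₃} e₁ e₂ e₃ = acyclic (x₁ , x₂ ∷ x₃ ∷ [] ,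
    ((~⇒≢ e₁ ∷ ≢-sym (~⇒≢ e₃) ∷ []) ∷ (~⇒≢ e₂ ∷ []) ∷ [] ∷ []) ,
    s≤s (s≤s z≤n) , (e₁ , e₂ , e₃ , tt))

  ¬cycle₄ : ∀ {x₁ x₂ x₃ x₄} → x₁ ~ x₂ → x₂ ~ x₃ → x₃ ~ x₄ → x₄ ~ x₁ → x₁ ≢ x₃ → x₂ ≢ x₄ → ⊥
  ¬cycle₄ {x₁} {x₂} {x₃} {x₄} e₁ e₂ e₃ e₄ d₁₃ d₂₄ =
    acyclic (x₁ , x₂ ∷ x₃ ∷ x₄ ∷ [] ,
    ((~⇒≢ e₁ ∷ d₁₃ ∷ ≢-sym (~⇒≢ e₄) ∷ []) ∷ (~⇒≢ e₂ ∷ d₂₄ ∷ []) ∷ (~⇒≢ e₃ ∷ []) ∷ [] ∷ []) ,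
    s≤s (s≤s z≤n) , (e₁ , e₂ , e₃ , e₄ , tt))

  ¬cycle₅ : ∀ {x₁ x₂ x₃ x₄ x₅} → x₁ ~ x₂ → x₂ ~ x₃ → x₃ ~ x₄ → x₄ ~ x₅ → x₅ ~ x₁ →
            x₁ ≢ x₃ → x₁ ≢ x₄ → x₂ ≢ x₄ → x₂ ≢ x₅ → x₃ ≢ x₅ → ⊥
  ¬cycle₅ {x₁} {x₂} {x₃} {x₄} {x₅} e₁ e₂ e₃ e₄ e₅ d₁₃ d₁₄ d₂₄ d₂₅ d₃₅ =
    acyclic (x₁ , x₂ ∷ x₃ ∷ x₄ ∷ x₅ ∷ [] ,
    ((~⇒≢ e₁ ∷ d₁₃ ∷ d₁₄ ∷ ≢-sym (~⇒≢ e₅) ∷ []) ∷ (~⇒≢ e₂ ∷ d₂₄ ∷ d₂₅ ∷ []) ∷ (~⇒≢ e₃ ∷ d₃₅ ∷ []) ∷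
     (~⇒≢ e₄ ∷ []) ∷ [] ∷ []) ,
    s≤s (s≤s z≤n) , (e₁ , e₂ , e₃ , e₄ , e₅ , tt))

  ¬cycle₆ : ∀ {x₁ x₂ x₃ x₄ x₅ x₆} → x₁ ~ x₂ → x₂ ~ x₃ → x₃ ~ x₄ → x₄ ~ x₅ → x₅ ~ x₆ → x₆ ~ x₁ →
            x₁ ≢ x₃ → x₁ ≢ x₄ → x₁ ≢ x₅ → x₂ ≢ x₄ → x₂ ≢ x₅ → x₂ ≢ x₆ → x₃ ≢ x₅ → x₃ ≢ x₆ → x₄ ≢ x₆ → ⊥
  ¬cycle₆ {x₁} {x₂} {x₃} {x₄} {x₅} {x₆} e₁ e₂ e₃ e₄ e₅ e₆ d₁₃ d₁₄ d₁₅ d₂₄ d₂₅ d₂₆ d₃₅ d₃₆ d₄₆ =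
    acyclic (x₁ , x₂ ∷ x₃ ∷ x₄ ∷ x₅ ∷ x₆ ∷ [] ,
    ((~⇒≢ e₁ ∷ d₁₃ ∷ d₁₄ ∷ d₁₅ ∷ ≢-sym (~⇒≢ e₆) ∷ []) ∷ (~⇒≢ e₂ ∷ d₂₄ ∷ d₂₅ ∷ d₂₆ ∷ []) ∷
     (~⇒≢ e₃ ∷ d₃₅ ∷ d₃₆ ∷ []) ∷ (~⇒≢ e₄ ∷ d₄₆ ∷ []) ∷ (~⇒≢ e₅ ∷ []) ∷ [] ∷ []) ,
    s≤s (s≤s z≤n) , (e₁ , e₂ , e₃ , e₄ , e₅ , e₆ , tt))

  ¬cycle₇ : ∀ {x₁ x₂ x₃ x₄ x₅ x₆ x₇} →
            x₁ ~ x₂ → x₂ ~ x₃ → x₃ ~ x₄ → x₄ ~ x₅ → x₅ ~ x₆ → x₆ ~ x₇ → x₇ ~ x₁ →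
            x₁ ≢ x₃ → x₁ ≢ x₄ → x₁ ≢ x₅ → x₁ ≢ x₆ → x₂ ≢ x₄ → x₂ ≢ x₅ → x₂ ≢ x₆ → x₂ ≢ x₇ →
            x₃ ≢ x₅ → x₃ ≢ x₆ → x₃ ≢ x₇ → x₄ ≢ x₆ → x₄ ≢ x₇ → x₅ ≢ x₇ → ⊥
  ¬cycle₇ {x₁} {x₂} {x₃} {x₄} {x₅} {x₆} {x₇} e₁ e₂ e₃ e₄ e₅ e₆ e₇
          d₁₃ d₁₄ d₁₅ d₁₆ d₂₄ d₂₅ d₂₆ d₂₇ d₃₅ d₃₆ d₃₇ d₄₆ d₄₇ d₅₇ =
    acyclic (x₁ , x₂ ∷ x₃ ∷ x₄ ∷ x₅ ∷ x₆ ∷ x₇ ∷ [] ,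
    ((~⇒≢ e₁ ∷ d₁₃ ∷ d₁₄ ∷ d₁₅ ∷ d₁₆ ∷ ≢-sym (~⇒≢ e₇) ∷ []) ∷ (~⇒≢ e₂ ∷ d₂₄ ∷ d₂₅ ∷ d₂₆ ∷ d₂₇ ∷ []) ∷
     (~⇒≢ e₃ ∷ d₃₅ ∷ d₃₆ ∷ d₃₇ ∷ []) ∷ (~⇒≢ e₄ ∷ d₄₆ ∷ d₄₇ ∷ []) ∷ (~⇒≢ e₅ ∷ d₅₇ ∷ []) ∷
     (~⇒≢ e₆ ∷ []) ∷ [] ∷ []) ,
    s≤s (s≤s z≤n) , (e₁ , e₂ , e₃ , e₄ , e₅ , e₆ , e₇ , tt))

module DiameterThree {n : ℕ} (G : Graph n) (acyclic : ¬ HasCycle G)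
                     (diam≤3 : ∀ x y → DistLE G x y 3) where
  open Adjacency G
  open Acyclic G acyclic

  data Walk≤3 (x y : Fin n) : Set where
    walk₀ : x ≡ y → Walk≤3 x y
    walk₁ : x ~ y → Walk≤3 x y
    walk₂ : ∀ p → x ~ p → p ~ y → Walk≤3 x y
    walk₃ : ∀ p q → x ~ p → p ~ q → q ~ y → Walk≤3 x y

  walk≤3 : ∀ x y → Walk≤3 x y
  walk≤3 x y = unfold (proj₂ (proj₂ (diam≤3 x y))) (proj₁ (proj₂ (diam≤3 x y)))
    where
    unfold : ∀ {x y j} → Walk G x y j → j ≤ 3 → Walk≤3 x y
    unfold here                                   _ = walk₀ refl
    unfold (step e here)                          _ = walk₁ e
    unfold (step e (step e′ here))                _ = walk₂ _ e e′
    unfold (step e (step e′ (step e″ here)))      _ = walk₃ _ _ e e′ e″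
    unfold (step _ (step _ (step _ (step _ _)))) (s≤s (s≤s (s≤s ())))

  record IsSpine (u a b v : Fin n) : Set where
    field
      u~a  : u ~ a
      a~b  : a ~ b
      b~v  : b ~ v
      ¬u~b : ¬ u ~ b
      ¬a~v : ¬ a ~ v
      ¬u~v : ¬ u ~ v
      u≢v  : u ≢ v

  reverse : ∀ {u a b v} → IsSpine u a b v → IsSpine v b a u
  reverse S = record
    { u~a = ~-sym b~v ; a~b = ~-sym a~b ; b~v = ~-sym u~a
    ; ¬u~b = ¬a~v ∘ ~-sym ; ¬a~v = ¬u~b ∘ ~-sym ; ¬u~v = ¬u~v ∘ ~-sym ; u≢v = ≢-sym u≢v }
    where open IsSpine S

  spine : ∀ {x y} → ¬ DistLE G x y 2 → ∃ λ a → ∃ λ b → IsSpine x a b y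
  spine {x} {y} x≁y with diam≤3 x y
  ... | _ , _ , here = ⊥-elim (x≁y (0 , z≤n , here))
  ... | _ , _ , step e here = ⊥-elim (x≁y (1 , s≤s z≤n , step e here))
  ... | _ , _ , step e (step e′ here) = ⊥-elim (x≁y (2 , ≤-refl , step e (step e′ here)))
  ... | _ , _ , step e (step e′ (step e″ here)) = _ , _ , record
    { u~a = e ; a~b = e′ ; b~v = e″
    ; ¬u~b = λ x~b → x≁y (2 , ≤-refl , step x~b (step e″ here))
    ; ¬a~v = λ a~y → x≁y (2 , ≤-refl , step e (step a~y here))
    ; ¬u~v = λ x~y → x≁y (1 , s≤s z≤n , step x~y here)
    ; u≢v  = λ { refl → x≁y (0 , z≤n , here) } }
  ... | _ , s≤s (s≤s (s≤s ())) , step _ (step _ (step _ (step _ _)))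

  module Spine {u a b v} (S : IsSpine u a b v) where
    open IsSpine S

    u≢b : u ≢ b
    u≢b refl = ¬u~v b~v

    a≢v : a ≢ v
    a≢v refl = ¬u~v u~a

    -- A neighbour z ≢ a of u would be at distance 4 from v, through the path z u a b v.
    module _ {z} (z~u : z ~ u) (z≢a : z ≢ a) where

      private
        z≢b : z ≢ b
        z≢b refl = ¬u~b (~-sym z~u)

        z≢v : z ≢ v
        z≢v refl = ¬u~v (~-sym z~u)

      ¬z~v : ¬ z ~ v
      ¬z~v z~v = ¬cycle₅ z~u u~a a~b b~v (~-sym z~v) z≢a z≢b u≢b u≢v a≢v

      ¬walk₂ : ∀ {p} → z ~ p → p ~ v → ⊥
      ¬walk₂ {p} z~p p~v with p Fin.≟ b
      ... | yes refl = ¬cycle₄ z~u u~a a~b (~-sym z~p) z≢a u≢b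
      ... | no p≢b   = ¬cycle₆ z~u u~a a~b b~v (~-sym p~v) (~-sym z~p)
                         z≢a z≢b z≢v u≢b u≢v u≢p a≢v (≢-sym p≢a) (≢-sym p≢b)
        where
        p≢a : p ≢ a
        p≢a refl = ¬a~v p~v
        u≢p : u ≢ p
        u≢p refl = ¬u~v p~v

      ¬walk₃-via-b : ∀ {p} → z ~ p → p ~ b → ⊥
      ¬walk₃-via-b {p} z~p p~b with p Fin.≟ a | p Fin.≟ v
      ... | yes refl | _        = ¬cycle₃ z~u u~a (~-sym z~p)
      ... | no _     | yes refl = ¬z~v z~p
      ... | no p≢a   | no _     = ¬cycle₅ z~u u~a a~b (~-sym p~b) (~-sym z~p) z≢a z≢b u≢b u≢p (≢-sym p≢a)
        where
        u≢p : u ≢ p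
        u≢p refl = ¬u~b p~b

      ¬walk₃-avoiding-b : ∀ {p q} → z ~ p → p ~ q → q ~ v → q ≢ b → ⊥
      ¬walk₃-avoiding-b {p} {q} z~p p~q q~v q≢b =
        cases (q Fin.≟ z) (p Fin.≟ v) (p Fin.≟ b) (p Fin.≟ a) (p Fin.≟ u)
        where
        q≢a : q ≢ a
        q≢a refl = ¬a~v q~v
        q≢u : q ≢ u
        q≢u refl = ¬u~v q~v
        cases : Dec (q ≡ z) → Dec (p ≡ v) → Dec (p ≡ b) → Dec (p ≡ a) → Dec (p ≡ u) → ⊥
        cases (yes refl) _ _ _ _ = ¬z~v q~v
        cases _ (yes refl) _ _ _ = ¬z~v z~p
        cases _ _ (yes refl) _ _ = ¬cycle₃ p~q q~v (~-sym b~v)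
        cases _ _ _ (yes refl) _ = ¬cycle₄ p~q q~v (~-sym b~v) (~-sym a~b) a≢v q≢b
        cases _ _ _ _ (yes refl) =
          ¬cycle₅ p~q q~v (~-sym b~v) (~-sym a~b) (~-sym u~a) u≢v u≢b q≢b q≢a (≢-sym a≢v)
        cases (no q≢z) (no p≢v) (no p≢b) (no p≢a) (no p≢u) =
          ¬cycle₇ z~u u~a a~b b~v (~-sym q~v) (~-sym p~q) (~-sym z~p)
            z≢a z≢b z≢v (≢-sym q≢z) u≢b u≢v (≢-sym q≢u) (≢-sym p≢u)
            a≢v (≢-sym q≢a) (≢-sym p≢a) (≢-sym q≢b) (≢-sym p≢b) (≢-sym p≢v)

      ¬walk≤3 : Walk≤3 z v → ⊥
      ¬walk≤3 (walk₀ z≡v)             = z≢v z≡v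
      ¬walk≤3 (walk₁ z~v)             = ¬z~v z~v
      ¬walk≤3 (walk₂ _ z~p p~v)       = ¬walk₂ z~p p~v
      ¬walk≤3 (walk₃ _ q z~p p~q q~v) with q Fin.≟ b
      ... | yes refl = ¬walk₃-via-b z~p p~q
      ... | no q≢b   = ¬walk₃-avoiding-b z~p p~q q~v q≢b

    end-nbr : ∀ {z} → z ~ u → z ≡ a
    end-nbr {z} z~u with z Fin.≟ a
    ... | yes z≡a = z≡a
    ... | no z≢a  = ⊥-elim (¬walk≤3 z~u z≢a (walk≤3 z v))

  module DoubleStarOfSpine {u a b v} (S : IsSpine u a b v) where
    open IsSpine S
    open Spine S using (u≢b; a≢v; end-nbr)
    open Spine (reverse S) using () renaming (end-nbr to end-nbrʳ)

    leaf-hub : ∀ {w} → w ≢ a → w ≢ b → w ~ a ⊎ w ~ b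
    leaf-hub {w} w≢a w≢b with w ~? a | w ~? b
    ... | yes w~a | _       = inj₁ w~a
    ... | no _    | yes w~b = inj₂ w~b
    ... | no ¬w~a | no ¬w~b = ⊥-elim (via-v (walk≤3 w v))
      where
      via-v : Walk≤3 w v → ⊥
      via-v (walk₀ refl)             = ¬w~b (~-sym b~v)
      via-v (walk₁ w~v)              = w≢b (end-nbrʳ w~v)
      via-v (walk₂ p w~p p~v)        = ¬w~b (subst (w ~_) (end-nbrʳ p~v) w~p)
      via-v (walk₃ p q w~p p~q q~v) with end-nbrʳ q~v | p Fin.≟ a | p Fin.≟ v
      ... | refl | yes refl | _        = ¬w~a w~p
      ... | refl | no _     | yes refl = w≢b (end-nbrʳ w~p)
      ... | refl | no p≢a   | no _     = via-u (walk≤3 w u)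
        where
        via-u : Walk≤3 w u → ⊥
        via-u (walk₀ refl)             = ¬cycle₄ u~a a~b (~-sym p~q) (~-sym w~p) u≢b (≢-sym p≢a)
        via-u (walk₁ w~u)              = w≢a (end-nbr w~u)
        via-u (walk₂ r w~r r~u)        = ¬w~a (subst (w ~_) (end-nbr r~u) w~r)
        via-u (walk₃ r s w~r r~s s~u) with end-nbr s~u | r Fin.≟ b | r Fin.≟ p
        ... | refl | yes refl | _        = ¬w~b w~r
        ... | refl | no _     | yes refl = ¬cycle₃ r~s a~b (~-sym p~q)
        ... | refl | no r≢b   | no r≢p   =
          ¬cycle₅ w~p p~q (~-sym a~b) (~-sym r~s) (~-sym w~r) w≢b w≢a p≢a (≢-sym r≢p) (≢-sym r≢b)

    leaf-nbr : ∀ {w y} → w ≢ a → w ≢ b → w ~ y → y ≡ a ⊎ y ≡ b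
    leaf-nbr {w} {y} w≢a w≢b w~y with y Fin.≟ a | y Fin.≟ b
    ... | yes y≡a | _       = inj₁ y≡a
    ... | no _    | yes y≡b = inj₂ y≡b
    ... | no y≢a  | no y≢b with leaf-hub y≢a y≢b | leaf-hub w≢a w≢b
    ...   | inj₁ y~a | inj₁ w~a = ⊥-elim (¬cycle₃ w~y y~a (~-sym w~a))
    ...   | inj₁ y~a | inj₂ w~b = ⊥-elim (¬cycle₄ w~y y~a a~b (~-sym w~b) w≢a y≢b)
    ...   | inj₂ y~b | inj₁ w~a = ⊥-elim (¬cycle₄ w~y y~b (~-sym a~b) (~-sym w~a) w≢b y≢a)
    ...   | inj₂ y~b | inj₂ w~b = ⊥-elim (¬cycle₃ w~y y~b (~-sym w~b))

    isDoubleStar : IsDoubleStar G a b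
    isDoubleStar = record
      { centres-adj = a~b
      ; pendantᵃ    = u , u~a , u≢b
      ; pendantᵇ    = v , ~-sym b~v , ≢-sym a≢v
      ; leaf-hub    = leaf-hub
      ; leaf-nbr    = leaf-nbr
      ; ¬adj-both   = λ w~a w~b → ¬cycle₃ w~a a~b (~-sym w~b)
      }

diameter-3-tree-is-double-star : ∀ {n} {G : Graph n} → IsTree G → Diameter3 G →
                                 ∃ λ a → ∃ λ b → IsDoubleStar G a b
diameter-3-tree-is-double-star {G = G} (_ , acyclic) (diam≤3 , _ , _ , far) =
  let a , b , S = spine far in a , b , DoubleStarOfSpine.isDoubleStar S
  where open DiameterThree G acyclic diam≤3

module DoubleStar {m : ℕ} {G : Graph (suc m)} {a b : Fin (suc m)} (D : IsDoubleStar G a b) where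
  open Adjacency G
  open IsDoubleStar D

  IsCentre : Fin (suc m) → Set
  IsCentre x = x ≡ a ⊎ x ≡ b

  centre? : ∀ x → Dec (IsCentre x)
  centre? x = x Fin.≟ a ⊎-dec x Fin.≟ b

  a≢b : a ≢ b
  a≢b = ~⇒≢ centres-adj

  stem : Fin (suc m) → Fin (suc m)
  stem x = if adj G x b then b else a

  stem-centre : ∀ x → IsCentre (stem x)
  stem-centre x with adj G x b
  ... | true  = inj₂ refl
  ... | false = inj₁ refl

  stem-a : stem a ≡ b
  stem-a rewrite centres-adj = refl

  stem-b : stem b ≡ a
  stem-b rewrite irrefl G b = refl

  stem-adj : ∀ x → x ~ stem x
  stem-adj x with adj G x b in x~b? | centre? x
  ... | true  | _                = x~b?
  ... | false | yes (inj₁ refl)  = contradiction (trans (sym centres-adj) x~b?) λ ()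
  ... | false | yes (inj₂ refl)  = ~-sym centres-adj
  ... | false | no ¬c with leaf-hub (¬c ∘ inj₁) (¬c ∘ inj₂)
  ...   | inj₁ x~a = x~a
  ...   | inj₂ x~b = contradiction (trans (sym x~b) x~b?) λ ()

  leaf-stem-unique : ∀ {x y} → ¬ IsCentre x → x ~ y → y ≡ stem x
  leaf-stem-unique {x} ¬c x~y with adj G x b in x~b? | leaf-nbr (¬c ∘ inj₁) (¬c ∘ inj₂) x~y
  ... | true  | inj₁ refl = ⊥-elim (¬adj-both x~y x~b?)
  ... | true  | inj₂ refl = refl
  ... | false | inj₁ refl = refl
  ... | false | inj₂ refl = contradiction (trans (sym x~y) x~b?) λ ()

  centres-stem : ∀ {x y} → IsCentre x → IsCentre y → x ≢ y → y ≡ stem x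
  centres-stem (inj₁ refl) (inj₁ refl) x≢y = ⊥-elim (x≢y refl)
  centres-stem (inj₁ refl) (inj₂ refl) _   = sym stem-a
  centres-stem (inj₂ refl) (inj₁ refl) _   = sym stem-b
  centres-stem (inj₂ refl) (inj₂ refl) x≢y = ⊥-elim (x≢y refl)

  edge-is-stem : ∀ {u v} → u ~ v → v ≡ stem u ⊎ u ≡ stem v
  edge-is-stem {u} {v} u~v with centre? u | centre? v
  ... | _      | no ¬cv = inj₂ (leaf-stem-unique ¬cv (~-sym u~v))
  ... | yes cu | yes cv = inj₁ (centres-stem cu cv (~⇒≢ u~v))
  ... | no ¬cu | yes _  = inj₁ (leaf-stem-unique ¬cu u~v)

  stem-edge-centre : ∀ {x} → IsCentre x → SameEdge (x , stem x) (a , b)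
  stem-edge-centre (inj₁ refl) = inj₁ (refl , stem-a)
  stem-edge-centre (inj₂ refl) = inj₂ (refl , stem-b)

  -- ι numbers the vertices other than b and gives b the number of a, matching the edge {r , stem r}.
  ι : Fin (suc m) → Fin m
  ι x with b Fin.≟ x
  ... | yes _  = punchOut (a≢b ∘ sym)
  ... | no b≢x = punchOut b≢x

  ι-a≡ι-b : ι a ≡ ι b
  ι-a≡ι-b with b Fin.≟ a | b Fin.≟ b
  ... | yes b≡a | _       = ⊥-elim (a≢b (sym b≡a))
  ... | no _    | yes _   = Finₚ.punchOut-cong b refl
  ... | no _    | no b≢b  = ⊥-elim (b≢b refl)

  ι-centre : ∀ {x} → IsCentre x → ι x ≡ ι b
  ι-centre (inj₁ refl) = ι-a≡ι-b
  ι-centre (inj₂ refl) = refl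

  ι-injective : ∀ {x y} → ι x ≡ ι y → x ≡ y ⊎ (IsCentre x × IsCentre y)
  ι-injective {x} {y} ιx≡ιy with b Fin.≟ x | b Fin.≟ y
  ... | yes refl | yes refl = inj₁ refl
  ... | yes refl | no b≢y   = inj₂ (inj₂ refl , inj₁ (sym (Finₚ.punchOut-injective _ b≢y ιx≡ιy)))
  ... | no b≢x   | yes refl = inj₂ (inj₁ (Finₚ.punchOut-injective b≢x _ ιx≡ιy) , inj₂ refl)
  ... | no b≢x   | no b≢y   = inj₁ (Finₚ.punchOut-injective b≢x b≢y ιx≡ιy)

  ι≡⇒same-stem-edge : ∀ {x y} → ι x ≡ ι y → SameEdge (x , stem x) (y , stem y)
  ι≡⇒same-stem-edge ιx≡ιy with ι-injective ιx≡ιy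
  ... | inj₁ refl       = SameEdge-refl
  ... | inj₂ (cx , cy)  = SameEdge-trans (stem-edge-centre cx) (SameEdge-sym (stem-edge-centre cy))

  same-stem-edge⇒ι≡ : ∀ {x y} → SameEdge (x , stem x) (y , stem y) → ι x ≡ ι y
  same-stem-edge⇒ι≡ (inj₁ (refl , _))      = refl
  same-stem-edge⇒ι≡ (inj₂ (refl , sx≡y))   =
    trans (ι-centre (stem-centre _)) (sym (ι-centre (subst IsCentre sx≡y (stem-centre _))))

  colour : Fin (suc m) → Fin (suc m) → Fin m
  colour u v = if does (v Fin.≟ stem u) then ι u else ι v

  colour-stem : ∀ x → colour x (stem x) ≡ ι x
  colour-stem x with stem x Fin.≟ stem x
  ... | yes _ = refl
  ... | no ≢  = ⊥-elim (≢ refl)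

  colour-via-stem : ∀ {u v} → u ~ v → ∃ λ r → SameEdge (u , v) (r , stem r) × colour u v ≡ ι r
  colour-via-stem {u} {v} u~v with v Fin.≟ stem u | edge-is-stem u~v
  ... | yes v≡su | _          = u , inj₁ (refl , v≡su) , refl
  ... | no v≢su  | inj₁ v≡su  = ⊥-elim (v≢su v≡su)
  ... | no _     | inj₂ u≡sv  = v , inj₂ (u≡sv , refl) , refl

  colour-injective : ∀ {u v u′ v′} → u ~ v → u′ ~ v′ →
                     colour u v ≡ colour u′ v′ → SameEdge (u , v) (u′ , v′)
  colour-injective u~v u′~v′ same-colour with colour-via-stem u~v | colour-via-stem u′~v′
  ... | r , uv≐r , cuv≡ιr | r′ , u′v′≐r′ , cu′v′≡ιr′ =
    SameEdge-trans uv≐r (SameEdge-trans (ι≡⇒same-stem-edge ιr≡ιr′) (SameEdge-sym u′v′≐r′))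
    where ιr≡ιr′ = trans (sym cuv≡ιr) (trans same-colour cu′v′≡ιr′)

  colour-cong : ∀ {u v u′ v′} → u ~ v → u′ ~ v′ →
                SameEdge (u , v) (u′ , v′) → colour u v ≡ colour u′ v′
  colour-cong u~v u′~v′ uv≐u′v′ with colour-via-stem u~v | colour-via-stem u′~v′
  ... | r , uv≐r , cuv≡ιr | r′ , u′v′≐r′ , cu′v′≡ιr′ =
    trans cuv≡ιr (trans (same-stem-edge⇒ι≡ r≐r′) (sym cu′v′≡ιr′))
    where r≐r′ = SameEdge-trans (SameEdge-sym uv≐r) (SameEdge-trans uv≐u′v′ u′v′≐r′)

  isEdgeColouring : IsEdgeColouring G colour
  isEdgeColouring u v u~v = colour-cong u~v (~-sym u~v) SameEdge-swap

  proper : Proper G colour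
  proper u v w u~v u~w v≢w same-colour with colour-injective u~v u~w same-colour
  ... | inj₁ (_ , v≡w)  = v≢w v≡w
  ... | inj₂ (u≡w , _)  = ~⇒≢ u~w u≡w

  Incident : Fin (suc m) → Fin (suc m) → Set
  Incident x r = x ≡ r ⊎ x ≡ stem r

  ι∈Col⇔Incident : ∀ {x} r → _∈Col_ G colour (ι r) x ⇔ Incident x r
  ι∈Col⇔Incident {x} r = mk⇔ to from
    where
    to : _∈Col_ G colour (ι r) x → Incident x r
    to (y , x~y , cxy≡ιr) with colour-via-stem x~y
    ... | r′ , xy≐r′ , cxy≡ιr′
        with SameEdge-trans xy≐r′ (ι≡⇒same-stem-edge (trans (sym cxy≡ιr′) cxy≡ιr))
    ...   | inj₁ (x≡r , _)   = inj₁ x≡r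
    ...   | inj₂ (x≡sr , _)  = inj₂ x≡sr
    from : Incident x r → _∈Col_ G colour (ι r) x
    from (inj₁ refl) = stem r , stem-adj r , colour-stem r
    from (inj₂ refl) =
      r , ~-sym (stem-adj r) , trans (isEdgeColouring _ r (~-sym (stem-adj r))) (colour-stem r)

  private
    u   = proj₁ pendantᵃ
    u~a = proj₁ (proj₂ pendantᵃ)
    u≢b = proj₂ (proj₂ pendantᵃ)

  a≡stem-u : a ≡ stem u
  a≡stem-u = leaf-stem-unique [ ~⇒≢ u~a , u≢b ]′ u~a

  a-incidences-⊈-b : ¬ (∀ r → Incident a r → Incident b r)
  a-incidences-⊈-b a⊆b with a⊆b u (inj₂ a≡stem-u)
  ... | inj₁ b≡u  = u≢b (sym b≡u)
  ... | inj₂ b≡su = a≢b (trans a≡stem-u (sym b≡su))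

  centre-incidences-injective : ∀ {x y} → IsCentre x → IsCentre y →
    (∀ r → Incident x r → Incident y r) → (∀ r → Incident y r → Incident x r) → x ≡ y
  centre-incidences-injective (inj₁ refl) (inj₁ refl) _   _   = refl
  centre-incidences-injective (inj₁ refl) (inj₂ refl) a⊆b _   = ⊥-elim (a-incidences-⊈-b a⊆b)
  centre-incidences-injective (inj₂ refl) (inj₁ refl) _   a⊆b = ⊥-elim (a-incidences-⊈-b a⊆b)
  centre-incidences-injective (inj₂ refl) (inj₂ refl) _   _   = refl

  incidences-injective : ∀ {x y} →
    (∀ r → Incident x r → Incident y r) → (∀ r → Incident y r → Incident x r) → x ≡ y
  incidences-injective {x} {y} x⊆y y⊆x with x⊆y x (inj₁ refl) | y⊆x y (inj₁ refl)
  ... | inj₁ y≡x  | _         = sym y≡x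
  ... | inj₂ _    | inj₁ x≡y  = x≡y
  ... | inj₂ y≡sx | inj₂ x≡sy =
    centre-incidences-injective (subst IsCentre (sym x≡sy) (stem-centre y))
                                (subst IsCentre (sym y≡sx) (stem-centre x)) x⊆y y⊆x

  vertexDistinguishing : VertexDistinguishing G colour
  vertexDistinguishing x y x≢y same-colours =
    x≢y (incidences-injective (transfer same-colours) (transfer (⇔-sym ∘ same-colours)))
    where
    transfer : ∀ {x y} → (∀ α → _∈Col_ G colour α x ⇔ _∈Col_ G colour α y) →
               ∀ r → Incident x r → Incident y r
    transfer same r =
      Equivalence.to (ι∈Col⇔Incident r) ∘ Equivalence.to (same (ι r)) ∘ Equivalence.from (ι∈Col⇔Incident r)

  equitable : Equitable G colour
  equitable = edge-injective⇒equitable G colour colour-injective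

  module LowerBound {k : ℕ} (c : Fin (suc m) → Fin (suc m) → Fin k)
                    (c-sym : IsEdgeColouring G c) (c-proper : Proper G c)
                    (c-distinguishing : VertexDistinguishing G c) where

    leaf-colour-set⊆ : ∀ {x y α} → ¬ IsCentre x → c x (stem x) ≡ c y (stem y) →
                       _∈Col_ G c α x → _∈Col_ G c α y
    leaf-colour-set⊆ {y = y} ¬cx same α∈x =
      stem y , stem-adj y , trans (sym same) (sym (∈Col-unique-nbr G c (leaf-stem-unique ¬cx) α∈x))

    leaf-stem-colour-injective : ∀ {x y} → ¬ IsCentre x → ¬ IsCentre y →
                                 c x (stem x) ≡ c y (stem y) → x ≡ y
    leaf-stem-colour-injective {x} {y} ¬cx ¬cy same with x Fin.≟ y
    ... | yes x≡y = x≡y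
    ... | no x≢y  = ⊥-elim (c-distinguishing x y x≢y λ α →
                      mk⇔ (leaf-colour-set⊆ ¬cx same) (leaf-colour-set⊆ ¬cy (sym same)))

    leaf-stem-colour-≢-central : ∀ {y} → ¬ IsCentre y → c y (stem y) ≢ c a b
    leaf-stem-colour-≢-central {y} ¬cy with stem y | stem-adj y | stem-centre y
    ... | _ | y~a | inj₁ refl = λ same → meeting-edges-colour-≢ G c c-sym c-proper
                                  y~a (~-sym centres-adj) (¬cy ∘ inj₂) (trans same (c-sym a b centres-adj))
    ... | _ | y~b | inj₂ refl = meeting-edges-colour-≢ G c c-sym c-proper y~b centres-adj (¬cy ∘ inj₁)

    stem-colour-injective : ∀ {x y} → x ≢ b → y ≢ b → c x (stem x) ≡ c y (stem y) → x ≡ y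
    stem-colour-injective {x} {y} x≢b y≢b same with centre? x | centre? y
    ... | yes (inj₂ x≡b)  | _               = ⊥-elim (x≢b x≡b)
    ... | _               | yes (inj₂ y≡b)  = ⊥-elim (y≢b y≡b)
    ... | yes (inj₁ refl) | yes (inj₁ refl) = refl
    ... | yes (inj₁ refl) | no ¬cy          =
      ⊥-elim (leaf-stem-colour-≢-central ¬cy (trans (sym same) (cong (c a) stem-a)))
    ... | no ¬cx          | yes (inj₁ refl) =
      ⊥-elim (leaf-stem-colour-≢-central ¬cx (trans same (cong (c a) stem-a)))
    ... | no ¬cx          | no ¬cy          = leaf-stem-colour-injective ¬cx ¬cy same

    colours-≥ : m ≤ k
    colours-≥ = Finₚ.injective⇒≤ {f = λ i → c (punchIn b i) (stem (punchIn b i))} λ same →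
      Finₚ.punchIn-injective b _ _ (stem-colour-injective (punchInᵢ≢i b _) (punchInᵢ≢i b _) same)

  degree-leaf : ∀ {x} → ¬ IsCentre x → degree G x ≡ 1
  degree-leaf {x} ¬cx = ΣFin-point _ (stem x) (cong b2n (stem-adj x)) off-stem
    where
    off-stem : ∀ y → y ≢ stem x → b2n (adj G x y) ≡ 0
    off-stem y y≢sx with adj G x y in x~y
    ... | true  = ⊥-elim (y≢sx (leaf-stem-unique ¬cx x~y))
    ... | false = refl

  degree-centre : ∀ {x} → IsCentre x → 2 ≤ degree G x
  degree-centre (inj₁ refl) = ΣFin-≥2 _ (u≢b ∘ sym) (~⇒1≤b2n centres-adj) (~⇒1≤b2n (~-sym u~a))
  degree-centre (inj₂ refl) with pendantᵇ
  ... | v , v~b , v≢a = ΣFin-≥2 _ (v≢a ∘ sym) (~⇒1≤b2n (~-sym centres-adj)) (~⇒1≤b2n (~-sym v~b))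

  is-leaf-leaf : ∀ {x} → ¬ IsCentre x → b2n (does (degree G x ℕ.≟ 1)) ≡ 1
  is-leaf-leaf {x} ¬cx rewrite dec-true (degree G x ℕ.≟ 1) (degree-leaf ¬cx) = refl

  is-leaf-centre : ∀ {x} → IsCentre x → b2n (does (degree G x ℕ.≟ 1)) ≡ 0
  is-leaf-centre {x} cx
    rewrite dec-false (degree G x ℕ.≟ 1) (λ deg≡1 → 1+n≰n (subst (2 ≤_) deg≡1 (degree-centre cx))) = refl

  suc-n₁≡m : suc (n₁ G) ≡ m
  suc-n₁≡m = begin
    suc (ΣFin (suc m) is-leaf)                ≡⟨ cong suc (ΣFin-removeAt is-leaf b) ⟩
    suc (is-leaf b + ΣFin m is-leaf∘punchIn)  ≡⟨ cong (λ k → suc (k + ΣFin m is-leaf∘punchIn)) is-leaf-b ⟩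
    suc (ΣFin m is-leaf∘punchIn)              ≡⟨ ΣFin-allBut is-leaf∘punchIn (punchOut b≢a) at-a elsewhere ⟩
    m                                         ∎
    where
    open ≡-Reasoning
    is-leaf : Fin (suc m) → ℕ
    is-leaf x = b2n (does (degree G x ℕ.≟ 1))
    is-leaf∘punchIn = removeAt is-leaf b
    b≢a = a≢b ∘ sym
    is-leaf-b : is-leaf b ≡ 0
    is-leaf-b = is-leaf-centre (inj₂ refl)
    at-a : is-leaf (punchIn b (punchOut b≢a)) ≡ 0
    at-a = trans (cong is-leaf (punchIn-punchOut b≢a)) (is-leaf-centre (inj₁ refl))
    elsewhere : ∀ i → i ≢ punchOut b≢a → is-leaf (punchIn b i) ≡ 1
    elsewhere i i≢a′ = is-leaf-leaf [ ≢a , punchInᵢ≢i b i ]′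
      where
      ≢a : punchIn b i ≢ a
      ≢a ≡a = i≢a′ (Finₚ.punchIn-injective b _ _ (trans ≡a (sym (punchIn-punchOut b≢a))))

  hasEqVdec : HasEqVdec G m
  hasEqVdec = colour , (isEdgeColouring , proper , vertexDistinguishing) , equitable

  hasVdec⇒≥ : ∀ k → HasVdec G k → m ≤ k
  hasVdec⇒≥ k (c , c-sym , c-proper , c-distinguishing) =
    LowerBound.colours-≥ c c-sym c-proper c-distinguishing

double-star-chromatic-indices : ∀ {m} {G : Graph (suc m)} {a b} → IsDoubleStar G a b →
  ChiS≡ G (n₁ G + 1) × ChiES≡ G (n₁ G + 1)
double-star-chromatic-indices {m} {G} D rewrite +-comm (n₁ G) 1 | DoubleStar.suc-n₁≡m D =
  (vdec , hasVdec⇒≥) , (hasEqVdec , λ k (c , c-vdec , _) → hasVdec⇒≥ k (c , c-vdec))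
  where
  open DoubleStar D
  vdec : HasVdec G m
  vdec = proj₁ hasEqVdec , proj₁ (proj₂ hasEqVdec)

lemma2 : ∀ {n : ℕ} (T : Graph n) → IsTree T → Diameter3 T →
    ChiS≡ T (n₁ T + 1) × ChiES≡ T (n₁ T + 1)
lemma2 {zero}  T _    (_ , () , _)
lemma2 {suc m} T tree diam with diameter-3-tree-is-double-star tree diam
... | _ , _ , D = double-star-chromatic-indices D
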